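{- Assume the setting described in the context. Let $\alpha:X\multimap\overline{F_\tau}X$ satisfy $[\nu_X,e_X]\cdot m'_X\cdot\overline{F_\tau}\alpha\le m_X\cdot\overline{F}^{*}\underline{\alpha}\cdot[\nu_X,e_X]$. Then $\underline{\alpha^{\bigstar}}\le\underline{\alpha}^{\divideontimes}$.
   Context: Let $\mathsf{C}$ be a category with binary coproducts and $(T,\mu,\eta)$ a monad on $\mathsf{C}$. In the Kleisli category $\mathcal{K}l(T)$ (objects of $\mathsf{C}$; morphisms $X\multimap Y$ are $\mathsf{C}$-morphisms $X\to TY$; composition $g\cdot f=\mu_Z\circ Tg\circ f$; identity $1_X=\eta_X$) write $f^\sharp=\eta_Y\circ f$ for $f:X\to Y$ in $\mathsf{C}$; coproducts of $\mathcal{K}l(T)$ are those of $\mathsf{C}$, with coprojections $\iota^1,\iota^2$ and cotupling $[-,-]$. $\mathcal{K}l(T)$ is order-enriched (hom-sets are posets, composition monotone) and $T$ is an order saturation monad: for every $\alpha:X\multimap X$ there is $\alpha^{*}:X\multimap X$ with (a) $1\le\alpha^*$, (b) $\alpha\le\alpha^*$, (c) $\alpha^*\cdot\alpha^*\le\alpha^*$, (d) if $\beta:X\multimap X$ satisfies $1\le\beta$, $\alpha\le\beta$, $\beta\cdot\beta\le\beta$ then $\alpha^*\le\beta$, (e) for all $f:X\to Y$ in $\mathsf{C}$, $\beta:Y\multimap Y$ and $\Box\in\{\le,\ge\}$: $f^\sharp\cdot\alpha\mathrel{\Box}\beta\cdot f^\sharp$ implies $f^\sharp\cdot\alpha^*\mathrel{\Box}\beta^*\cdot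 f^\sharp$. A functor $S$ on $\mathsf{C}$ lifts to $\overline{S}$ on $\mathcal{K}l(T)$ if $\overline{S}X=SX$ and $\overline{S}(f^\sharp)=(Sf)^\sharp$; if $(\overline{S},m,e)$ is a monad on $\mathcal{K}l(T)$ then $TS$ is a monad on $\mathsf{C}$ whose Kleisli category is $\mathcal{K}l(\overline{S})$, with hom-sets $Hom_{\mathcal{K}l(T)}(X,\overline{S}Y)$ ordered as in $\mathcal{K}l(T)$. Standing assumptions: $\mathcal{K}l(T)$ has zero morphisms $0_{X,Y}$ (with $f\cdot 0=0=0\cdot g$). $F:\mathsf{C}\to\mathsf{C}$ lifts to $\overline{F}$, so $F_\tau=F+\mathcal{I}d$ lifts to $\overline{F_\tau}=\overline{F}+\mathcal{I}d$, which is a monad $(\overline{F_\tau},m',e')$ on $\mathcal{K}l(T)$ with $e'_X=\iota^2:X\multimap\overline{F}X+X$ and $m'_X=[\iota^1,id]\cdot(\overline{F}([0,id])+id):\overline{F}(\overline{F}X+X)+(\overline{F}X+X)\multimap\overline{F}X+X$. $F$ admits all free $F$-algebras, giving the free monad $F^*$ on $\mathsf{C}$ with unit $\varepsilon$ and universal transformation $\nu':F\Rightarrow F^*$; it lifts to $\overline{F}^*$ on $\mathcal{K}l(T)$ and $(\overline{F}^*,m,e)$ is the free monad over $\overline{F}$ in $\mathcal{K}l(T)$ with universal natural transformation $\nu:\overline{F}\Rightarrow\overline{F}^*$, where $e=\varepsilon^\sharp$, $\nu=\nu'^\sharp$. For both $(\overline{S},m,e)=(\overline{F_\tau},m',e')$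 and $(\overline{S},m,e)=(\overline{F}^*,m,e)$, $\overline{S}$ is locally monotonic and $m_X\cdot\overline{S}[(m_X\cdot\overline{S}\alpha)^*\cdot e_X]=(m_X\cdot\overline{S}\alpha)^*$ for all $\alpha:X\multimap\overline{S}X$. For $\alpha:X\multimap\overline{F_\tau}X$ put $\alpha^{\bigstar}=(m'_X\cdot\overline{F_\tau}\alpha)^*\cdot e'_X$, and for $\beta:Y\multimap\overline{F}^*Y$ put $\beta^{\divideontimes}=(m_Y\cdot\overline{F}^*\beta)^*\cdot e_Y$. For $\alpha:X\multimap\overline{F_\tau}X$ let $\underline{\alpha}=[\nu_X,e_X]\cdot\alpha:X\multimap\overline{F}^*X$; the order is that of $\mathcal{K}l(T)$. -}

module Defs where

open import Level using (Level; _⊔_) renaming (suc to lsuc)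
open import Relation.Binary.PropositionalEquality using (_≡_)
open import Relation.Binary.Structures using (IsPartialOrder)
open import Data.Product using (Σ; _×_)

module RawCat {o ℓ : Level} {Obj : Set o} (Hom : Obj → Obj → Set ℓ)
  (idm : ∀ {A} → Hom A A)
  (_∘_ : ∀ {A B C} → Hom B C → Hom A B → Hom A C) where

  record IsFunctor (F₀ : Obj → Obj)
                   (F₁ : ∀ {A B} → Hom A B → Hom (F₀ A) (F₀ B)) : Set (o ⊔ ℓ) where
    field
      F-id : ∀ {A} → F₁ (idm {A}) ≡ idm
      F-∘  : ∀ {A B C} (g : Hom B C) (f : Hom A B) → F₁ (g ∘ f) ≡ (F₁ g ∘ F₁ f)

  record Functor : Set (o ⊔ ℓ) where
    field
      F₀ : Obj → Obj
      F₁ : ∀ {A B} → Hom A B → Hom (F₀ A) (F₀ B)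
      isFunctor : IsFunctor F₀ F₁

  IsNatural : (F₀ : Obj → Obj) (F₁ : ∀ {A B} → Hom A B → Hom (F₀ A) (F₀ B))
              (G₀ : Obj → Obj) (G₁ : ∀ {A B} → Hom A B → Hom (G₀ A) (G₀ B))
              (θ : ∀ X → Hom (F₀ X) (G₀ X)) → Set (o ⊔ ℓ)
  IsNatural F₀ F₁ G₀ G₁ θ = ∀ {A B} (f : Hom A B) → (G₁ f ∘ θ A) ≡ (θ B ∘ F₁ f)

  record IsMonad (M₀ : Obj → Obj) (M₁ : ∀ {A B} → Hom A B → Hom (M₀ A) (M₀ B))
                 (η : ∀ X → Hom X (M₀ X)) (μ : ∀ X → Hom (M₀ (M₀ X)) (M₀ X))
                 : Set (o ⊔ ℓ) where
    field
      isFunctor : IsFunctor M₀ M₁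
      η-natural : ∀ {A B} (f : Hom A B) → (M₁ f ∘ η A) ≡ (η B ∘ f)
      μ-natural : ∀ {A B} (f : Hom A B) → (M₁ f ∘ μ A) ≡ (μ B ∘ M₁ (M₁ f))
      μ-assoc   : ∀ X → (μ X ∘ M₁ (μ X)) ≡ (μ X ∘ μ (M₀ X))
      μ-unitˡ   : ∀ X → (μ X ∘ M₁ (η X)) ≡ idm
      μ-unitʳ   : ∀ X → (μ X ∘ η (M₀ X)) ≡ idm

  record Monad : Set (o ⊔ ℓ) where
    field
      M₀ : Obj → Obj
      M₁ : ∀ {A B} → Hom A B → Hom (M₀ A) (M₀ B)
      η  : ∀ X → Hom X (M₀ X)
      μ  : ∀ X → Hom (M₀ (M₀ X)) (M₀ X)
      isMonad : IsMonad M₀ M₁ η μ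

  record IsMonadMorphism (M N : Monad) (θ : ∀ X → Hom (Monad.M₀ M X) (Monad.M₀ N X))
                         : Set (o ⊔ ℓ) where
    private
      module M = Monad M
      module N = Monad N
    field
      natural : IsNatural M.M₀ M.M₁ N.M₀ N.M₁ θ
      unit    : ∀ X → (θ X ∘ M.η X) ≡ N.η X
      mult    : ∀ X → (θ X ∘ M.μ X) ≡ (N.μ X ∘ (N.M₁ (θ X) ∘ θ (M.M₀ X)))

  record IsFreeMonadOver (F : Functor) (M : Monad)
                         (ν : ∀ X → Hom (Functor.F₀ F X) (Monad.M₀ M X)) : Set (o ⊔ ℓ) where
    private
      module F = Functor F
      module M = Monad M
    field
      ν-natural : IsNatural F.F₀ F.F₁ M.M₀ M.M₁ ν
      universal : (N : Monad) (λ' : ∀ X → Hom (F.F₀ X) (Monad.M₀ N X)) →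
                  IsNatural F.F₀ F.F₁ (Monad.M₀ N) (Monad.M₁ N) λ' →
                  Σ (∀ X → Hom (M.M₀ X) (Monad.M₀ N X))
                    (λ θ → IsMonadMorphism M N θ × (∀ X → (θ X ∘ ν X) ≡ λ' X))
      unique    : (N : Monad) (λ' : ∀ X → Hom (F.F₀ X) (Monad.M₀ N X))
                  (θ θ' : ∀ X → Hom (M.M₀ X) (Monad.M₀ N X)) →
                  IsMonadMorphism M N θ → IsMonadMorphism M N θ' →
                  (∀ X → (θ X ∘ ν X) ≡ λ' X) → (∀ X → (θ' X ∘ ν X) ≡ λ' X) →
                  ∀ X → θ X ≡ θ' X

record Setting (o ℓ r : Level) : Set (lsuc (o ⊔ ℓ ⊔ r)) where
  infixr 9 _∘_
  infixr 9 _·_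
  infix 4 _≤_
  field
    Obj : Set o
    Hom : Obj → Obj → Set ℓ
    idC : ∀ {A} → Hom A A
    _∘_ : ∀ {A B C} → Hom B C → Hom A B → Hom A C
    ∘-idˡ  : ∀ {A B} (f : Hom A B) → (idC ∘ f) ≡ f
    ∘-idʳ  : ∀ {A B} (f : Hom A B) → (f ∘ idC) ≡ f
    ∘-assoc : ∀ {A B C D} (h : Hom C D) (g : Hom B C) (f : Hom A B) →
              ((h ∘ g) ∘ f) ≡ (h ∘ (g ∘ f))
    _⊕_ : Obj → Obj → Obj
    inl : ∀ {A B} → Hom A (A ⊕ B)
    inr : ∀ {A B} → Hom B (A ⊕ B)
    [_,_] : ∀ {A B C} → Hom A C → Hom B C → Hom (A ⊕ B) C
    inl-β : ∀ {A B C} (f : Hom A C) (g : Hom B C) → ([ f , g ] ∘ inl) ≡ f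
    inr-β : ∀ {A B C} (f : Hom A C) (g : Hom B C) → ([ f , g ] ∘ inr) ≡ g
    ⊕-unique : ∀ {A B C} (f : Hom A C) (g : Hom B C) (h : Hom (A ⊕ B) C) →
               (h ∘ inl) ≡ f → (h ∘ inr) ≡ g → h ≡ [ f , g ]

  module C = RawCat Hom idC _∘_

  field
    T : C.Monad

  open C.Monad T public using () renaming (M₀ to T₀; M₁ to T₁; η to ηT; μ to μT)

  KHom : Obj → Obj → Set ℓ
  KHom X Y = Hom X (T₀ Y)

  _·_ : ∀ {X Y Z} → KHom Y Z → KHom X Y → KHom X Z
  g · f = μT _ ∘ (T₁ g ∘ f)

  kid : ∀ {X} → KHom X X
  kid = ηT _

  _♯ : ∀ {X Y} → Hom X Y → KHom X Y
  f ♯ = ηT _ ∘ f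

  module K = RawCat KHom kid _·_

  field
    _≤_ : ∀ {X Y} → KHom X Y → KHom X Y → Set r
    ≤-isPartialOrder : ∀ {X Y} → IsPartialOrder (_≡_ {A = KHom X Y}) _≤_
    ·-mono : ∀ {X Y Z} {f f' : KHom X Y} {g g' : KHom Y Z} →
             f ≤ f' → g ≤ g' → (g · f) ≤ (g' · f')
    _* : ∀ {X} → KHom X X → KHom X X
    sat-a : ∀ {X} (α : KHom X X) → kid ≤ (α *)
    sat-b : ∀ {X} (α : KHom X X) → α ≤ (α *)
    sat-c : ∀ {X} (α : KHom X X) → ((α *) · (α *)) ≤ (α *)
    sat-d : ∀ {X} (α β : KHom X X) → kid ≤ β → α ≤ β → (β · β) ≤ β → (α *) ≤ β
    sat-e≤ : ∀ {X Y} (f : Hom X Y) (α : KHom X X) (β : KHom Y Y) →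
             ((f ♯) · α) ≤ (β · (f ♯)) → ((f ♯) · (α *)) ≤ ((β *) · (f ♯))
    sat-e≥ : ∀ {X Y} (f : Hom X Y) (α : KHom X X) (β : KHom Y Y) →
             (β · (f ♯)) ≤ ((f ♯) · α) → ((β *) · (f ♯)) ≤ ((f ♯) · (α *))
    0m : ∀ {X Y} → KHom X Y
    0-left  : ∀ {X Y Z} (f : KHom Y Z) → (f · 0m {X} {Y}) ≡ 0m
    0-right : ∀ {X Y Z} (g : KHom X Y) → (0m {Y} {Z} · g) ≡ 0m

  ι¹ : ∀ {A B} → KHom A (A ⊕ B)
  ι¹ = inl ♯

  ι² : ∀ {A B} → KHom B (A ⊕ B)
  ι² = inr ♯

  field
    F : C.Functor

  open C.Functor F public using () renaming (F₀ to F₀; F₁ to F₁)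

  field
    F̄₁ : ∀ {A B} → KHom A B → KHom (F₀ A) (F₀ B)
    F̄-isFunctor : K.IsFunctor F₀ F̄₁
    F̄-lift : ∀ {A B} (f : Hom A B) → F̄₁ (f ♯) ≡ (F₁ f) ♯

  F̄ : K.Functor
  F̄ = record { F₀ = F₀ ; F₁ = F̄₁ ; isFunctor = F̄-isFunctor }

  Fτ₀ : Obj → Obj
  Fτ₀ X = F₀ X ⊕ X

  Fτ₁ : ∀ {A B} → KHom A B → KHom (Fτ₀ A) (Fτ₀ B)
  Fτ₁ h = [ ι¹ · F̄₁ h , ι² · h ]

  e' : ∀ X → KHom X (Fτ₀ X)
  e' X = ι²

  m' : ∀ X → KHom (Fτ₀ (Fτ₀ X)) (Fτ₀ X)
  m' X = [ ι¹ , kid ] · [ ι¹ · F̄₁ [ 0m , kid ] , ι² · kid ]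

  field
    Fτ-isMonad : K.IsMonad Fτ₀ Fτ₁ e' m'

  field
    F*₀ : Obj → Obj
    F*₁ : ∀ {A B} → Hom A B → Hom (F*₀ A) (F*₀ B)
    ε   : ∀ X → Hom X (F*₀ X)
    μ*  : ∀ X → Hom (F*₀ (F*₀ X)) (F*₀ X)
    F*-isMonad : C.IsMonad F*₀ F*₁ ε μ*
    ν'  : ∀ X → Hom (F₀ X) (F*₀ X)
    F*-free : C.IsFreeMonadOver F
                (record { M₀ = F*₀ ; M₁ = F*₁ ; η = ε ; μ = μ* ; isMonad = F*-isMonad }) ν'

  e : ∀ X → KHom X (F*₀ X)
  e X = ε X ♯

  ν : ∀ X → KHom (F₀ X) (F*₀ X)
  ν X = ν' X ♯

  field
    F̄*₁ : ∀ {A B} → KHom A B → KHom (F*₀ A) (F*₀ B)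
    F̄*-lift : ∀ {A B} (f : Hom A B) → F̄*₁ (f ♯) ≡ (F*₁ f) ♯
    m : ∀ X → KHom (F*₀ (F*₀ X)) (F*₀ X)
    F̄*-isMonad : K.IsMonad F*₀ F̄*₁ e m
    F̄*-free : K.IsFreeMonadOver F̄
                (record { M₀ = F*₀ ; M₁ = F̄*₁ ; η = e ; μ = m ; isMonad = F̄*-isMonad }) ν

  field
    Fτ-locMono : ∀ {A B} {α β : KHom A B} → α ≤ β → Fτ₁ α ≤ Fτ₁ β
    F̄*-locMono : ∀ {A B} {α β : KHom A B} → α ≤ β → F̄*₁ α ≤ F̄*₁ β
    Fτ-sat : ∀ {X} (α : KHom X (Fτ₀ X)) →
             (m' X · Fτ₁ (((m' X · Fτ₁ α) *) · e' X)) ≡ ((m' X · Fτ₁ α) *)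
    F̄*-sat : ∀ {X} (α : KHom X (F*₀ X)) →
             (m X · F̄*₁ (((m X · F̄*₁ α) *) · e X)) ≡ ((m X · F̄*₁ α) *)

  _★ : ∀ {X} → KHom X (Fτ₀ X) → KHom X (Fτ₀ X)
  α ★ = ((m' _ · Fτ₁ α) *) · e' _

  _⊛ : ∀ {Y} → KHom Y (F*₀ Y) → KHom Y (F*₀ Y)
  β ⊛ = ((m _ · F̄*₁ β) *) · e _

  under : ∀ {X} → KHom X (Fτ₀ X) → KHom X (F*₀ X)
  under {X} α = [ ν X , e X ] · α

-- The cotuple [ν_X , e_X] is the image of the pure C-morphism [ν'_X , ε_X], so
-- saturation axiom (e) transports the hypothesis, a simulation of m'·F̄_τ α by
-- m·F̄*α̲ along it, to their saturations. Precomposing with ι² = e'_X and using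
-- [ν_X , e_X] · ι² = e_X then turns the left side into α^★ and the right into α̲^⊛.
module Submission where

open import Level using (Level)
open import Defs
open import Relation.Binary.PropositionalEquality
open import Relation.Binary.Bundles using (Poset)
open import Relation.Binary.Structures using (IsPartialOrder)

module KleisliFacts {o ℓ r : Level} (S : Setting o ℓ r) where
  open Setting S
  open C.IsMonad (C.Monad.isMonad T) using (η-natural; μ-natural; μ-assoc; μ-unitʳ)
  open C.IsFunctor (C.IsMonad.isFunctor (C.Monad.isMonad T)) using (F-∘)

  KPoset : Obj → Obj → Poset ℓ ℓ r
  KPoset X Y = record { Carrier = KHom X Y ; _≈_ = _≡_ ; _≤_ = _≤_
                      ; isPartialOrder = ≤-isPartialOrder }

  ≤-refl : ∀ {X Y} {f : KHom X Y} → f ≤ f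
  ≤-refl = IsPartialOrder.refl ≤-isPartialOrder

  ·-assoc : ∀ {W X Y Z} (h : KHom Y Z) (g : KHom X Y) (f : KHom W X) →
            (h · g) · f ≡ h · (g · f)
  ·-assoc h g f = begin
    μT _ ∘ (T₁ (μT _ ∘ (T₁ h ∘ g)) ∘ f)
      ≡⟨ cong (λ z → μT _ ∘ (z ∘ f)) (trans (F-∘ _ _) (cong (T₁ (μT _) ∘_) (F-∘ _ _))) ⟩
    μT _ ∘ ((T₁ (μT _) ∘ (T₁ (T₁ h) ∘ T₁ g)) ∘ f)
      ≡⟨ cong (μT _ ∘_) (∘-assoc _ _ _) ⟩
    μT _ ∘ (T₁ (μT _) ∘ ((T₁ (T₁ h) ∘ T₁ g) ∘ f))
      ≡⟨ sym (∘-assoc _ _ _) ⟩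
    (μT _ ∘ T₁ (μT _)) ∘ ((T₁ (T₁ h) ∘ T₁ g) ∘ f)
      ≡⟨ cong (_∘ ((T₁ (T₁ h) ∘ T₁ g) ∘ f)) (μ-assoc _) ⟩
    (μT _ ∘ μT _) ∘ ((T₁ (T₁ h) ∘ T₁ g) ∘ f)
      ≡⟨ ∘-assoc _ _ _ ⟩
    μT _ ∘ (μT _ ∘ ((T₁ (T₁ h) ∘ T₁ g) ∘ f))
      ≡⟨ cong (λ z → μT _ ∘ (μT _ ∘ z)) (∘-assoc _ _ _) ⟩
    μT _ ∘ (μT _ ∘ (T₁ (T₁ h) ∘ (T₁ g ∘ f)))
      ≡⟨ cong (μT _ ∘_) (sym (∘-assoc _ _ _)) ⟩
    μT _ ∘ ((μT _ ∘ T₁ (T₁ h)) ∘ (T₁ g ∘ f))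
      ≡⟨ cong (λ z → μT _ ∘ (z ∘ (T₁ g ∘ f))) (sym (μ-natural h)) ⟩
    μT _ ∘ ((T₁ h ∘ μT _) ∘ (T₁ g ∘ f))
      ≡⟨ cong (μT _ ∘_) (∘-assoc _ _ _) ⟩
    μT _ ∘ (T₁ h ∘ (μT _ ∘ (T₁ g ∘ f))) ∎
    where open ≡-Reasoning

  ·-♯ : ∀ {X Y Z} (h : KHom Y Z) (f : Hom X Y) → h · (f ♯) ≡ h ∘ f
  ·-♯ h f = begin
    μT _ ∘ (T₁ h ∘ (ηT _ ∘ f)) ≡⟨ cong (μT _ ∘_) (sym (∘-assoc _ _ _)) ⟩
    μT _ ∘ ((T₁ h ∘ ηT _) ∘ f) ≡⟨ cong (λ z → μT _ ∘ (z ∘ f)) (η-natural h) ⟩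
    μT _ ∘ ((ηT _ ∘ h) ∘ f)    ≡⟨ cong (μT _ ∘_) (∘-assoc _ _ _) ⟩
    μT _ ∘ (ηT _ ∘ (h ∘ f))    ≡⟨ sym (∘-assoc _ _ _) ⟩
    (μT _ ∘ ηT _) ∘ (h ∘ f)    ≡⟨ cong (_∘ (h ∘ f)) (μ-unitʳ _) ⟩
    idC ∘ (h ∘ f)              ≡⟨ ∘-idˡ _ ⟩
    h ∘ f                      ∎
    where open ≡-Reasoning

  cotuple-ι² : ∀ {A B Z} (f : KHom A Z) (g : KHom B Z) → [ f , g ] · ι² ≡ g
  cotuple-ι² f g = trans (·-♯ [ f , g ] inr) (inr-β f g)

  cotuple-♯ : ∀ {A B Z} (f : Hom A Z) (g : Hom B Z) → [ f ♯ , g ♯ ] ≡ [ f , g ] ♯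
  cotuple-♯ f g = sym (⊕-unique _ _ _
    (trans (∘-assoc _ _ _) (cong (ηT _ ∘_) (inl-β f g)))
    (trans (∘-assoc _ _ _) (cong (ηT _ ∘_) (inr-β f g))))

  cotuple-♯-simulation-* : ∀ {A B Z} (f : Hom A Z) (g : Hom B Z)
    (α : KHom (A ⊕ B) (A ⊕ B)) (β : KHom Z Z) →
    [ f ♯ , g ♯ ] · α ≤ β · [ f ♯ , g ♯ ] →
    [ f ♯ , g ♯ ] · (α *) ≤ (β *) · [ f ♯ , g ♯ ]
  cotuple-♯-simulation-* f g α β sim
    rewrite cotuple-♯ f g = sat-e≤ [ f , g ] α β sim

lemma4 : ∀ {o ℓ r : Level} (S : Setting o ℓ r) → let open Setting S in
    ∀ {X : Obj} (α : KHom X (Fτ₀ X)) →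
    ([ ν X , e X ] · (m' X · Fτ₁ α)) ≤ ((m X · F̄*₁ (under α)) · [ ν X , e X ]) →
    under (α ★) ≤ (under α) ⊛
lemma4 S {X} α sim = begin
  u · (A * · ι²)   ≡⟨ ·-assoc u (A *) ι² ⟨
  (u · A *) · ι²   ≤⟨ ·-mono ≤-refl (cotuple-♯-simulation-* (ν' X) (ε X) A B sim) ⟩
  (B * · u) · ι²   ≡⟨ ·-assoc (B *) u ι² ⟩
  B * · (u · ι²)   ≡⟨ cong (B * ·_) (cotuple-ι² (ν X) (e X)) ⟩
  B * · e X        ∎
  where
  open Setting S
  open KleisliFacts S using (KPoset; ≤-refl; ·-assoc; cotuple-ι²; cotuple-♯-simulation-*)
  open import Relation.Binary.Reasoning.PartialOrder (KPoset X (F*₀ X))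
  u : KHom (Fτ₀ X) (F*₀ X)
  u = [ ν X , e X ]
  A : KHom (Fτ₀ X) (Fτ₀ X)
  A = m' X · Fτ₁ α
  B : KHom (F*₀ X) (F*₀ X)
  B = m X · F̄*₁ (under α)
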